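{- Let $R$ be a tree and let $X\subseteq V(R)$ with $|X|=n$, where $n$ is even. Call a partition $\{X_1,\dots,X_{n/2}\}$ of $X$ into sets of size two feasible (in $R$) if there are $n/2$ pairwise vertex-disjoint paths $P_1,\dots,P_{n/2}$ of $R$ such that, for $1\le i\le n/2$, the ends of $P_i$ are the two members of $X_i$. Then there is at most one feasible partition of $X$. -}

module Defs where

open import Level using (0ℓ)
open import Data.Nat using (ℕ; _+_; _≤_)
open import Data.Fin using (Fin)
open import Data.Product using (_×_; _,_; Σ; ∃; proj₁; proj₂)
open import Data.Sum using (_⊎_)
open import Data.Empty using (⊥)
open import Data.Maybe using (just)
open import Data.List using (List; []; _∷_; head; last; length; concatMap)
open import Data.List.Relation.Unary.Linked using (Linked)
open import Data.List.Relation.Unary.AllPairs using (AllPairs)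
open import Data.List.Relation.Unary.Unique.Propositional using (Unique)
open import Data.List.Relation.Binary.Pointwise using (Pointwise)
open import Data.List.Relation.Binary.Permutation.Propositional using (_↭_)
open import Data.List.Relation.Binary.Disjoint.Propositional using (Disjoint)
open import Data.List.Membership.Propositional using (_∈_)
open import Relation.Binary.PropositionalEquality using (_≡_)
open import Relation.Nullary using (¬_)
open import Function.Bundles using (_⇔_)

record Graph (m : ℕ) : Set₁ where
  field
    Adj   : Fin m → Fin m → Set
    sym   : ∀ {u v} → Adj u v → Adj v u
    irrefl : ∀ {u} → ¬ Adj u u
open Graph public

module _ {m : ℕ} (G : Graph m) where

  IsPath : Fin m → Fin m → List (Fin m) → Set
  IsPath a b p = Linked (Adj G) p × Unique p × head p ≡ just a × last p ≡ just b

  IsCycle : List (Fin m) → Set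
  IsCycle [] = ⊥
  IsCycle (v ∷ vs) = 3 ≤ length (v ∷ vs) × Linked (Adj G) (v ∷ vs) × Unique (v ∷ vs)
                     × ∃ λ w → last (v ∷ vs) ≡ just w × Adj G w v

  Connected : Set
  Connected = ∀ u v → ∃ λ p → IsPath u v p

  Acyclic : Set
  Acyclic = ∀ c → ¬ IsCycle c

  IsTree : Set
  IsTree = Connected × Acyclic

  -- A partition of X (a list of distinct vertices) into sets of size two,
  -- given as a list of pairs whose components together enumerate X exactly once.
  -- (Distinctness of the two members of each block follows from Unique X.)
  IsPairPartition : List (Fin m) → List (Fin m × Fin m) → Set
  IsPairPartition X ps = concatMap (λ { (a , b) → a ∷ b ∷ [] }) ps ↭ X

  Feasible : List (Fin m) → List (Fin m × Fin m) → Set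
  Feasible X ps = IsPairPartition X ps ×
    ∃ λ (paths : List (List (Fin m))) →
        Pointwise (λ p ab → IsPath (proj₁ ab) (proj₂ ab) p) paths ps
      × AllPairs Disjoint paths

IsBlock : {m : ℕ} → List (Fin m × Fin m) → Fin m → Fin m → Set
IsBlock ps a b = ((a , b) ∈ ps) ⊎ ((b , a) ∈ ps)

SamePartition : {m : ℕ} → List (Fin m × Fin m) → List (Fin m × Fin m) → Set
SamePartition ps qs = ∀ a b → IsBlock ps a b ⇔ IsBlock qs a b

{-# OPTIONS --safe #-}
-- Let {a, b} be a block of a feasible partition P, realised by the path p, and let Q be another
-- feasible partition. Deleting an edge xz of p splits the tree into two sides; p is the only path of
-- P crossing it, since the other ones avoid p, so an odd number of members of X lie on z's side. If no
-- path of Q contained both x and z, every path of Q would stay on one side and that number would be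
-- even. Hence consecutive vertices of p always lie on a common Q-path; as the Q-paths are disjoint, all
-- of p lies on the Q-path through a, and the only members of X on a Q-path are its two ends. So {a, b}
-- is a block of Q.
module Submission where

open import Defs hiding (sym)
open import Data.Nat using (ℕ; _+_; s≤s; z≤n)
open import Data.Fin using (Fin)
open import Data.Fin.Properties using (_≟_)
open import Data.Product using (_×_; ∃; ∃₂; _,_; proj₁; proj₂)
import Data.Product as Product
open import Data.Sum using (_⊎_; inj₁; inj₂)
import Data.Sum as Sum
open import Data.Empty using (⊥; ⊥-elim)
open import Data.Bool using (Bool; true; false; _xor_)
open import Data.Bool.Properties using (xor-assoc; xor-comm; not-involutive)
open import Data.Maybe using (just)
open import Data.Maybe.Properties using (just-injective)
open import Data.List using (List; []; _∷_; _++_; _ʳ++_; reverse; head; last; concatMap; length)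
open import Data.List.Properties using (∷-injectiveʳ)
open import Data.List.Relation.Unary.Linked using (Linked; []; [-]; _∷_)
import Data.List.Relation.Unary.Linked as Linked
open import Data.List.Relation.Unary.AllPairs using (AllPairs; []; _∷_)
open import Data.List.Relation.Unary.All using (All; []; _∷_)
import Data.List.Relation.Unary.All as All
open import Data.List.Relation.Unary.All.Properties using (¬Any⇒All¬)
open import Data.List.Relation.Unary.Any using (Any; here; there; any?)
import Data.List.Relation.Unary.Any as Any
open import Data.List.Relation.Unary.Unique.Propositional using (Unique)
open import Data.List.Relation.Binary.Pointwise using (Pointwise; []; _∷_)
open import Data.List.Relation.Binary.Permutation.Propositional using (_↭_; ↭-sym; ↭-trans; ↭⇒↭ₛ)
import Data.List.Relation.Binary.Permutation.Propositional as ↭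
import Data.List.Relation.Binary.Permutation.Setoid.Properties
open import Data.List.Relation.Binary.Permutation.Propositional.Properties
  using (Any-resp-↭; ↭-reverse)
open import Data.List.Relation.Binary.Disjoint.Propositional using (Disjoint)
open import Data.List.Relation.Binary.Subset.Propositional using (_⊆_)
open import Data.List.Membership.Propositional using (_∈_; _∉_; find)
open import Data.List.Membership.Propositional.Properties using (∈-++⁺ʳ; ∈-++⁻; ∈-∃++)
open import Relation.Binary.PropositionalEquality
  using (_≡_; _≢_; refl; sym; trans; cong; cong₂; subst; setoid; module ≡-Reasoning)
open import Relation.Nullary using (¬_; does; yes; no)
open import Relation.Nullary.Decidable using (toSum; _×-dec_; does-⇔; dec-true; dec-false)
open import Function using (_∘_)
open import Function.Bundles using (mk⇔)

module _ {A : Set} where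

  ∈-head : ∀ xs {z : A} → head xs ≡ just z → z ∈ xs
  ∈-head []       ()
  ∈-head (x ∷ xs) refl = here refl

  ∈-last : ∀ xs {z : A} → last xs ≡ just z → z ∈ xs
  ∈-last []           ()
  ∈-last (x ∷ [])     refl = here refl
  ∈-last (x ∷ y ∷ ys) eq   = there (∈-last (y ∷ ys) eq)

  last-++-∷ : ∀ xs (y : A) ys → last (xs ++ y ∷ ys) ≡ last (y ∷ ys)
  last-++-∷ []           y ys = refl
  last-++-∷ (x ∷ [])     y ys = refl
  last-++-∷ (x ∷ x′ ∷ xs) y ys = last-++-∷ (x′ ∷ xs) y ys

  head-ʳ++ : ∀ (x : A) xs ys → head (xs ʳ++ x ∷ ys) ≡ last (x ∷ xs)
  head-ʳ++ x []       ys = refl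
  head-ʳ++ x (y ∷ xs) ys = head-ʳ++ y xs (x ∷ ys)

  last-ʳ++ : ∀ xs (y : A) ys → last (xs ʳ++ y ∷ ys) ≡ last (y ∷ ys)
  last-ʳ++ []       y ys = refl
  last-ʳ++ (x ∷ xs) y ys = last-ʳ++ xs x (y ∷ ys)

  Unique-++⁻ʳ : ∀ xs {ys : List A} → Unique (xs ++ ys) → Unique ys
  Unique-++⁻ʳ []       u        = u
  Unique-++⁻ʳ (x ∷ xs) (_ ∷ u) = Unique-++⁻ʳ xs u

  Unique-++⇒∉ : ∀ xs {ys} {z : A} → Unique (xs ++ ys) → z ∈ ys → z ∉ xs
  Unique-++⇒∉ (x ∷ xs) (x∉ ∷ u) z∈ys (here refl) = All.lookup x∉ (∈-++⁺ʳ xs z∈ys) refl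
  Unique-++⇒∉ (x ∷ xs) (_  ∷ u) z∈ys (there z∈xs) = Unique-++⇒∉ xs u z∈ys z∈xs

  Unique-resp-↭ : ∀ {xs ys : List A} → xs ↭ ys → Unique xs → Unique ys
  Unique-resp-↭ = Setoid.Unique-resp-↭ ∘ ↭⇒↭ₛ
    where module Setoid = Data.List.Relation.Binary.Permutation.Setoid.Properties (setoid A)

  Unique-reverse : ∀ {xs : List A} → Unique xs → Unique (reverse xs)
  Unique-reverse {xs} = Unique-resp-↭ (↭-sym (↭-reverse xs))

  ∈-reverse⁻ : ∀ {xs} {z : A} → z ∈ reverse xs → z ∈ xs
  ∈-reverse⁻ {xs} = Any-resp-↭ (↭-reverse xs)

  module _ {R : A → A → Set} where

    Linked-ʳ++ : ∀ {x} xs {ys} → Linked (λ a b → R b a) (x ∷ xs) → Linked R (x ∷ ys) →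
                 Linked R (xs ʳ++ x ∷ ys)
    Linked-ʳ++ []       _             l = l
    Linked-ʳ++ (y ∷ xs) (ryx ∷ l⁻¹) l = Linked-ʳ++ xs l⁻¹ (ryx ∷ l)

    Linked-++⁻ʳ : ∀ xs {ys} → Linked R (xs ++ ys) → Linked R ys
    Linked-++⁻ʳ []       l = l
    Linked-++⁻ʳ (x ∷ xs) l = Linked-++⁻ʳ xs (Linked.tail l)

    infixes⇒Linked : ∀ xs → (∀ pre {x z} post → xs ≡ pre ++ x ∷ z ∷ post → R x z) → Linked R xs
    infixes⇒Linked []           r = []
    infixes⇒Linked (x ∷ [])     r = [-]
    infixes⇒Linked (x ∷ z ∷ xs) r =
      r [] xs refl ∷ infixes⇒Linked (z ∷ xs) (λ pre post eq → r (x ∷ pre) post (cong (x ∷_) eq))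

xor-swap : ∀ a b c → a xor (b xor c) ≡ b xor (a xor c)
xor-swap a b c = trans (sym (xor-assoc a b c)) (trans (cong (_xor c) (xor-comm a b)) (xor-assoc b a c))

xor-cancelˡ : ∀ b c → b xor (b xor c) ≡ c
xor-cancelˡ false c = refl
xor-cancelˡ true  c = not-involutive c

module _ {m : ℕ} (G : Graph m) where

  Adj⇒≢ : ∀ {x y} → Adj G x y → x ≢ y
  Adj⇒≢ xy refl = irrefl G xy

  IsPath-start∈ : ∀ {s t p} → IsPath G s t p → s ∈ p
  IsPath-start∈ {p = p} (_ , _ , hp , _) = ∈-head p hp

  IsPath-end∈ : ∀ {s t p} → IsPath G s t p → t ∈ p
  IsPath-end∈ {p = p} (_ , _ , _ , lp) = ∈-last p lp

  IsPath-∷ : ∀ {x y t p} → Adj G x y → IsPath G y t p → x ∉ p → IsPath G x t (x ∷ p)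
  IsPath-∷ {p = []}    _  (_ , _ , () , _)
  IsPath-∷ {p = _ ∷ p} xy (l , u , refl , lt) x∉ = xy ∷ l , ¬Any⇒All¬ _ x∉ ∷ u , refl , lt

  IsPath-suffix : ∀ {s t} pre {x} post → IsPath G s t (pre ++ x ∷ post) → IsPath G x t (x ∷ post)
  IsPath-suffix pre post (l , u , _ , lt) =
    Linked-++⁻ʳ pre l , Unique-++⁻ʳ pre u , refl , trans (sym (last-++-∷ pre _ post)) lt

  IsPath-start∉suffix : ∀ {s t} pre {x} post → IsPath G s t (pre ++ x ∷ post) → s ≢ x → s ∉ x ∷ post
  IsPath-start∉suffix []        post (_ , _ , refl , _) s≢x = λ _ → s≢x refl
  IsPath-start∉suffix (_ ∷ pre) post (_ , s∉ ∷ _ , refl , _) _ s∈ = All.lookup s∉ (∈-++⁺ʳ pre s∈) refl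

  IsPath-reverse : ∀ {s t p} → IsPath G s t p → IsPath G t s (reverse p)
  IsPath-reverse {p = []}    (_ , _ , () , _)
  IsPath-reverse {p = x ∷ p} (l , u , refl , lt) =
    Linked-ʳ++ p (Linked.map (Graph.sym G) l) [-] , Unique-reverse u ,
    trans (head-ʳ++ x p []) lt , last-ʳ++ p x []

  open import Data.List.Membership.DecPropositional (_≟_ {m}) using (_∈?_)

  path-join : ∀ {x y b p q} → IsPath G x b p → IsPath G y b q →
              ∃ λ r → IsPath G x y r × r ⊆ p ++ q
  path-join {p = []} (_ , _ , () , _)
  path-join {p = x ∷ []} {q} (_ , _ , refl , refl) Q =
    reverse q , IsPath-reverse Q , there ∘ ∈-reverse⁻ {xs = q}
  path-join {p = x ∷ x′ ∷ p} (xx′ ∷ l , _ ∷ u , refl , lt) Q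
    with path-join (l , u , refl , lt) Q
  ... | r , R , r⊆ with x ∈? r
  ...   | no  x∉ = x ∷ r , IsPath-∷ xx′ R x∉ ,
              λ { (here refl) → here refl ; (there z∈) → there (r⊆ z∈) }
  ...   | yes x∈ with ∈-∃++ x∈
  ...     | pre , post , refl = x ∷ post , IsPath-suffix pre post R ,
              λ { (here refl) → here refl ; (there z∈) → there (r⊆ (∈-++⁺ʳ pre (there z∈))) }

module _ {m : ℕ} {G : Graph m} (acyclic : Acyclic G) where

  -- Joining the two paths closes the cycle a, x, …, y.
  ¬detour : ∀ {a x y b p q} → Adj G a x → Adj G a y → x ≢ y →
            IsPath G x b p → IsPath G y b q → a ∉ p → a ∉ q → ⊥
  ¬detour {a} {p = p} {q} ax ay x≢y P Q a∉p a∉q with path-join G P Q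
  ... | [] , (_ , _ , () , _) , _
  ... | _ ∷ [] , (_ , _ , refl , refl) , _ = x≢y refl
  ... | x ∷ c ∷ r , (l , u , refl , ly) , r⊆ =
    acyclic (a ∷ x ∷ c ∷ r)
      (s≤s (s≤s (s≤s z≤n)) , ax ∷ l , ¬Any⇒All¬ _ a∉r ∷ u , _ , ly , Graph.sym G ay)
    where
    a∉r : a ∉ x ∷ c ∷ r
    a∉r a∈ = Sum.[ a∉p , a∉q ] (∈-++⁻ p (r⊆ a∈))

  path-unique : ∀ {a b} p q → IsPath G a b p → IsPath G a b q → p ≡ q
  path-unique []      _  (_ , _ , () , _) _
  path-unique (_ ∷ _) [] _ (_ , _ , () , _)
  path-unique (_ ∷ []) (_ ∷ []) (_ , _ , refl , _) (_ , _ , refl , _) = refl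
  path-unique (a ∷ []) (_ ∷ y ∷ q) (_ , _ , refl , refl) (_ , a∉ ∷ _ , refl , lq) =
    ⊥-elim (All.lookup a∉ (∈-last (y ∷ q) lq) refl)
  path-unique (a ∷ x ∷ p) (_ ∷ []) (_ , a∉ ∷ _ , refl , lp) (_ , _ , refl , refl) =
    ⊥-elim (All.lookup a∉ (∈-last (x ∷ p) lp) refl)
  path-unique (a ∷ x ∷ p) (_ ∷ y ∷ q)
              (ax ∷ lp , a∉p ∷ up , refl , ep) (ay ∷ lq , a∉q ∷ uq , refl , eq) =
    cong (a ∷_) (Sum.[ (λ x≡y → path-unique (x ∷ p) (y ∷ q) P (lq , uq , cong just (sym x≡y) , eq))
                     , (λ x≢y → ⊥-elim (¬detour ax ay x≢y P Q (a∉ a∉p) (a∉ a∉q)))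
                     ]′ (toSum (x ≟ y)))
    where
    P = (lp , up , refl , ep)
    Q = (lq , uq , refl , eq)
    a∉ : ∀ {r} → All (a ≢_) r → a ∉ r
    a∉ a≢ a∈ = All.lookup a≢ a∈ refl

module _ {A : Set} where

  ends : List (A × A) → List A
  ends []             = []
  ends ((x , y) ∷ ps) = x ∷ y ∷ ends ps

  concatMap-pairs≡ends : ∀ {f : A × A → List A} → (∀ x y → f (x , y) ≡ x ∷ y ∷ []) →
                         ∀ ps → concatMap f ps ≡ ends ps
  concatMap-pairs≡ends f≡ []             = refl
  concatMap-pairs≡ends f≡ ((x , y) ∷ ps) = cong₂ _++_ (f≡ x y) (concatMap-pairs≡ends f≡ ps)

  ∈-ends₁ : ∀ {ps} {a b : A} → (a , b) ∈ ps → a ∈ ends ps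
  ∈-ends₁ (here refl) = here refl
  ∈-ends₁ {_ ∷ _} (there ab∈) = there (there (∈-ends₁ ab∈))

  ∈-ends₂ : ∀ {ps} {a b : A} → (a , b) ∈ ps → b ∈ ends ps
  ∈-ends₂ (here refl) = there (here refl)
  ∈-ends₂ {_ ∷ _} (there ab∈) = there (there (∈-ends₂ ab∈))

  Unique-ends⇒≢ : ∀ {ps} {a b : A} → Unique (ends ps) → (a , b) ∈ ps → a ≢ b
  Unique-ends⇒≢ ((a≢b ∷ _) ∷ _) (here refl) = a≢b
  Unique-ends⇒≢ {_ ∷ _} (_ ∷ _ ∷ u) (there ab∈) = Unique-ends⇒≢ u ab∈

  AllPairs-Disjoint⇒≡ : ∀ {L : List (List A)} {r q x} → AllPairs Disjoint L →
                        r ∈ L → q ∈ L → x ∈ r → x ∈ q → r ≡ q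
  AllPairs-Disjoint⇒≡ (_  ∷ _) (here refl) (here refl) _   _   = refl
  AllPairs-Disjoint⇒≡ (r# ∷ _) (here refl) (there q∈) x∈r x∈q = ⊥-elim (All.lookup r# q∈ (x∈r , x∈q))
  AllPairs-Disjoint⇒≡ (q# ∷ _) (there r∈) (here refl) x∈r x∈q = ⊥-elim (All.lookup q# r∈ (x∈q , x∈r))
  AllPairs-Disjoint⇒≡ (_  ∷ D) (there r∈) (there q∈) x∈r x∈q = AllPairs-Disjoint⇒≡ D r∈ q∈ x∈r x∈q

  SharePath : List (List A) → A → A → Set
  SharePath L x z = ∃ λ r → r ∈ L × x ∈ r × z ∈ r

  SharePath-chain : ∀ {L q x xs} → AllPairs Disjoint L → q ∈ L →
                    Linked (SharePath L) (x ∷ xs) → x ∈ q → All (_∈ q) (x ∷ xs)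
  SharePath-chain D q∈ [-] x∈q = x∈q ∷ []
  SharePath-chain D q∈ ((r , r∈ , x∈r , z∈r) ∷ l) x∈q
    with AllPairs-Disjoint⇒≡ D r∈ q∈ x∈r x∈q
  ... | refl = x∈q ∷ SharePath-chain D q∈ l z∈r

module _ {m : ℕ} (G : Graph m) where

  Linkage : List (List (Fin m)) → List (Fin m × Fin m) → Set
  Linkage paths ps = Pointwise (λ p ab → IsPath G (proj₁ ab) (proj₂ ab) p) paths ps

  Linkage-lookup : ∀ {paths ps a b} → Linkage paths ps → (a , b) ∈ ps →
                   ∃ λ p → p ∈ paths × IsPath G a b p
  Linkage-lookup (P ∷ _) (here refl) = _ , here refl , P
  Linkage-lookup (_ ∷ L) (there ab∈) =
    Product.map₂ (Product.map₁ there) (Linkage-lookup L ab∈)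

  Linkage-Linked : ∀ {paths ps p} → Linkage paths ps → p ∈ paths → Linked (Adj G) p
  Linkage-Linked ((l , _) ∷ _) (here refl) = l
  Linkage-Linked (_ ∷ L)       (there p∈)  = Linkage-Linked L p∈

  Linkage-covers : ∀ {paths ps z} → Linkage paths ps → z ∈ ends ps → ∃ λ r → r ∈ paths × z ∈ r
  Linkage-covers (P ∷ _) (here refl)         = _ , here refl , IsPath-start∈ G P
  Linkage-covers (P ∷ _) (there (here refl)) = _ , here refl , IsPath-end∈ G P
  Linkage-covers {ps = _ ∷ _} (_ ∷ L) (there (there z∈)) =
    Product.map₂ (Product.map₁ there) (Linkage-covers L z∈)

  Linkage-shared⇒IsBlock : ∀ {paths qs q a b} → Linkage paths qs → AllPairs Disjoint paths →
                           q ∈ paths → a ∈ q → b ∈ q → a ∈ ends qs → b ∈ ends qs → a ≢ b →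
                           IsBlock qs a b
  Linkage-shared⇒IsBlock {r ∷ _} {(x , y) ∷ qs} {a = a} {b}
                         (_ ∷ L) (r# ∷ _) (here refl) a∈r b∈r a∈ b∈ a≢b =
    endpoints (on-r a∈ a∈r) (on-r b∈ b∈r)
    where
    on-r : ∀ {z} → z ∈ ends ((x , y) ∷ qs) → z ∈ r → z ≡ x ⊎ z ≡ y
    on-r (here z≡x)          _   = inj₁ z≡x
    on-r (there (here z≡y))  _   = inj₂ z≡y
    on-r (there (there z∈)) z∈r with Linkage-covers L z∈
    ... | r′ , r′∈ , z∈r′ = ⊥-elim (All.lookup r# r′∈ (z∈r , z∈r′))
    endpoints : a ≡ x ⊎ a ≡ y → b ≡ x ⊎ b ≡ y → IsBlock ((x , y) ∷ qs) a b
    endpoints (inj₁ refl) (inj₁ refl) = ⊥-elim (a≢b refl)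
    endpoints (inj₁ refl) (inj₂ refl) = inj₁ (here refl)
    endpoints (inj₂ refl) (inj₁ refl) = inj₂ (here refl)
    endpoints (inj₂ refl) (inj₂ refl) = ⊥-elim (a≢b refl)
  Linkage-shared⇒IsBlock {r ∷ _} {(x , y) ∷ qs} {q}
                         (R ∷ L) (r# ∷ D) (there q∈) a∈q b∈q a∈ b∈ a≢b =
    Sum.map there there (Linkage-shared⇒IsBlock L D q∈ a∈q b∈q (off-r a∈q a∈) (off-r b∈q b∈) a≢b)
    where
    off-r : ∀ {z} → z ∈ q → z ∈ ends ((x , y) ∷ qs) → z ∈ ends qs
    off-r z∈q (here refl)         = ⊥-elim (All.lookup r# q∈ (IsPath-start∈ G R , z∈q))
    off-r z∈q (there (here refl)) = ⊥-elim (All.lookup r# q∈ (IsPath-end∈ G R , z∈q))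
    off-r z∈q (there (there z∈))  = z∈

module EdgeSides {m : ℕ} {G : Graph m} (connected : Connected G) (acyclic : Acyclic G)
                 {u v : Fin m} (uv : Adj G u v) where

  open import Data.List.Membership.DecPropositional (_≟_ {m}) using (_∈?_)

  pathToU : Fin m → List (Fin m)
  pathToU w = proj₁ (connected w u)

  pathToU-isPath : ∀ w → IsPath G w u (pathToU w)
  pathToU-isPath w = proj₂ (connected w u)

  -- The side of the edge uv on which w lies in the forest G − uv: true on v's side.
  side : Fin m → Bool
  side w = does (v ∈? pathToU w)

  Crosses : Fin m → Fin m → Set
  Crosses w w′ = (w ≡ u × w′ ≡ v) ⊎ (w ≡ v × w′ ≡ u)

  pathToU-step : ∀ {w w′} → Adj G w w′ → pathToU w ≡ w ∷ pathToU w′ ⊎ pathToU w′ ≡ w′ ∷ pathToU w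
  pathToU-step {w} {w′} ww′ with w ∈? pathToU w′
  ... | no w∉ =
    inj₁ (path-unique acyclic _ _ (pathToU-isPath w) (IsPath-∷ G ww′ (pathToU-isPath w′) w∉))
  ... | yes w∈ with ∈-∃++ w∈
  ...   | pre , post , eq = inj₂ (begin
          pathToU w′      ≡⟨ path-unique acyclic _ _ (pathToU-isPath w′) (IsPath-∷ G w′w W w′∉) ⟩
          w′ ∷ w ∷ post   ≡⟨ cong (w′ ∷_) (path-unique acyclic _ _ W (pathToU-isPath w)) ⟩
          w′ ∷ pathToU w  ∎)
    where
    open ≡-Reasoning
    w′w = Graph.sym G ww′
    P : IsPath G w′ u (pre ++ w ∷ post)
    P = subst (IsPath G w′ u) eq (pathToU-isPath w′)
    W : IsPath G w u (w ∷ post)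
    W = IsPath-suffix G pre post P
    w′∉ : w′ ∉ w ∷ post
    w′∉ = IsPath-start∉suffix G pre post P (Adj⇒≢ G w′w)

  pathToU-u : pathToU u ≡ u ∷ []
  pathToU-u = path-unique acyclic _ _ (pathToU-isPath u) ([-] , [] ∷ [] , refl , refl)

  pathToU-v : pathToU v ≡ v ∷ u ∷ []
  pathToU-v = path-unique acyclic _ _ (pathToU-isPath v)
    (Graph.sym G uv ∷ [-] , (Adj⇒≢ G (Graph.sym G uv) ∷ []) ∷ [] ∷ [] , refl , refl)

  pathToU-v-next : ∀ {z} → pathToU v ≡ v ∷ pathToU z → z ≡ u
  pathToU-v-next {z} eq with pathToU-isPath z
  ... | _ , _ , hz , _ =
    just-injective (trans (sym hz) (cong head (∷-injectiveʳ (trans (sym eq) pathToU-v))))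

  side-u : side u ≡ false
  side-u = dec-false (v ∈? pathToU u) v∉
    where
    v∉ : v ∉ pathToU u
    v∉ v∈ with subst (v ∈_) pathToU-u v∈
    ... | here v≡u = Adj⇒≢ G uv (sym v≡u)

  side-v : side v ≡ true
  side-v = dec-true (v ∈? pathToU v) (IsPath-start∈ G (pathToU-isPath v))

  side-descend : ∀ {w w′} → pathToU w ≡ w ∷ pathToU w′ → ¬ (w ≡ v × w′ ≡ u) → side w ≡ side w′
  side-descend {w} {w′} eq ¬vu = does-⇔ (mk⇔ to from) (v ∈? pathToU w) (v ∈? pathToU w′)
    where
    to : v ∈ pathToU w → v ∈ pathToU w′
    to v∈ with subst (v ∈_) eq v∈
    ... | here refl = ⊥-elim (¬vu (refl , pathToU-v-next eq))
    ... | there v∈′ = v∈′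
    from : v ∈ pathToU w′ → v ∈ pathToU w
    from v∈ = subst (v ∈_) (sym eq) (there v∈)

  side-step : ∀ {w w′} → Adj G w w′ → ¬ Crosses w w′ → side w ≡ side w′
  side-step ww′ ¬cross with pathToU-step ww′
  ... | inj₁ eq = side-descend eq (¬cross ∘ inj₂)
  ... | inj₂ eq = sym (side-descend eq (¬cross ∘ inj₁ ∘ Product.swap))

  side-constant : ∀ {x y} p → IsPath G x y p → ¬ (u ∈ p × v ∈ p) → side x ≡ side y
  side-constant []           (_ , _ , () , _)
  side-constant (x ∷ [])     (_ , _ , refl , refl) _ = refl
  side-constant (x ∷ x′ ∷ p) (xx′ ∷ l , _ ∷ un , refl , lt) ¬uv =
    trans (side-step xx′ ¬cross)
          (side-constant (x′ ∷ p) (l , un , refl , lt) (λ (u∈ , v∈) → ¬uv (there u∈ , there v∈)))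
    where
    ¬cross : ¬ Crosses x x′
    ¬cross (inj₁ (refl , refl)) = ¬uv (here refl , there (here refl))
    ¬cross (inj₂ (refl , refl)) = ¬uv (there (here refl) , here refl)

  ¬Crosses : ∀ {x x′ xs} → u ∉ x ∷ xs → v ∉ x ∷ xs → ¬ Crosses x x′
  ¬Crosses u∉ v∉ (inj₁ (refl , _)) = u∉ (here refl)
  ¬Crosses u∉ v∉ (inj₂ (refl , _)) = v∉ (here refl)

  side-before-edge : ∀ {x} pre {rest} → Linked (Adj G) (x ∷ pre ++ u ∷ rest) →
                     u ∉ x ∷ pre → v ∉ x ∷ pre → side x ≡ false
  side-before-edge []         (xu ∷ _)  u∉ v∉ = trans (side-step xu (¬Crosses u∉ v∉)) side-u
  side-before-edge (x′ ∷ pre) (xx′ ∷ l) u∉ v∉ =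
    trans (side-step xx′ (¬Crosses u∉ v∉)) (side-before-edge pre l (u∉ ∘ there) (v∉ ∘ there))

  Traverses : List (Fin m) → Set
  Traverses r = ∃₂ λ pre post → r ≡ pre ++ u ∷ v ∷ post

  side-start : ∀ {x y} pre {post} → IsPath G x y (pre ++ u ∷ v ∷ post) → side x ≡ false
  side-start []        (_ , _ , refl , _) = side-u
  side-start (x ∷ pre) (l , un , refl , _) =
    side-before-edge pre l (Unique-++⇒∉ (x ∷ pre) un (here refl))
                           (Unique-++⇒∉ (x ∷ pre) un (there (here refl)))

  side-end : ∀ {x y} pre {post} → IsPath G x y (pre ++ u ∷ v ∷ post) → side y ≡ true
  side-end pre {post} P with IsPath-suffix G pre (v ∷ post) P
  ... | _ ∷ l , u∉ ∷ un , _ , ly =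
    trans (sym (side-constant (v ∷ post) (l , un , refl , ly) (λ (u∈ , _) → All.lookup u∉ u∈ refl)))
          side-v

  parity : List (Fin m) → Bool
  parity []       = false
  parity (x ∷ xs) = side x xor parity xs

  parity-↭ : ∀ {xs ys} → xs ↭ ys → parity xs ≡ parity ys
  parity-↭ ↭.refl         = refl
  parity-↭ (↭.prep x p)   = cong (side x xor_) (parity-↭ p)
  parity-↭ (↭.swap x y p) =
    trans (cong (λ b → side x xor (side y xor b)) (parity-↭ p)) (xor-swap (side x) (side y) _)
  parity-↭ (↭.trans p q)  = trans (parity-↭ p) (parity-↭ q)

  parity-balanced-block : ∀ {x y} ps → side x ≡ side y →
                          parity (ends ((x , y) ∷ ps)) ≡ parity (ends ps)
  parity-balanced-block {y = y} ps eq = trans (cong (_xor _) eq) (xor-cancelˡ (side y) _)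

  parity-balanced : ∀ {paths ps} → Linkage G paths ps → All (λ r → ¬ (u ∈ r × v ∈ r)) paths →
                    parity (ends ps) ≡ false
  parity-balanced [] [] = refl
  parity-balanced {ps = (_ , _) ∷ ps} (P ∷ L) (¬uv ∷ A) =
    trans (parity-balanced-block ps (side-constant _ P ¬uv)) (parity-balanced L A)

  parity-crossing : ∀ {paths ps} → Linkage G paths ps → AllPairs Disjoint paths →
                    Any Traverses paths → parity (ends ps) ≡ true
  parity-crossing {ps = (_ , _) ∷ ps} (P ∷ L) (r# ∷ _) (here (pre , post , refl))
    rewrite side-start pre P | side-end pre P
          | parity-balanced L (All.map (λ r#r′ (u∈ , _) → r#r′ (∈-++⁺ʳ pre (here refl) , u∈)) r#) = refl
  parity-crossing {ps = (_ , _) ∷ ps} (P ∷ L) (r# ∷ D) (there t) with find t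
  ... | r′ , r′∈ , pre , post , refl =
    trans (parity-balanced-block ps (side-constant _ P ¬uv)) (parity-crossing L D t)
    where
    ¬uv : ¬ (u ∈ _ × v ∈ _)
    ¬uv (u∈ , _) = All.lookup r# r′∈ (u∈ , ∈-++⁺ʳ pre (here refl))

module _ {m : ℕ} {G : Graph m} (connected : Connected G) (acyclic : Acyclic G) where

  open import Data.List.Membership.DecPropositional (_≟_ {m}) using (_∈?_)

  -- If no Q-path contained x and z, the number of ends on z's side of xz would be odd counted
  -- along P (only p crosses xz) and even counted along Q.
  edge-covered : ∀ {ps qs P Q p} → ends ps ↭ ends qs →
                 Linkage G P ps → AllPairs Disjoint P → Linkage G Q qs → p ∈ P →
                 ∀ pre {x z} post → p ≡ pre ++ x ∷ z ∷ post → SharePath Q x z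
  edge-covered {ps} {qs} {Q = Q} ps↭qs LP DP LQ p∈ pre {x} {z} post eq
    with any? (λ r → (x ∈? r) ×-dec (z ∈? r)) Q
  ... | yes shared  = find shared
  ... | no ¬shared = ⊥-elim (true≢false (begin
          true              ≡⟨ sym (parity-crossing LP DP p-traverses) ⟩
          parity (ends ps)  ≡⟨ parity-↭ ps↭qs ⟩
          parity (ends qs)  ≡⟨ parity-balanced LQ (¬Any⇒All¬ Q ¬shared) ⟩
          false             ∎))
    where
    xz : Adj G x z
    xz = Linked.head (Linked-++⁻ʳ pre (subst (Linked (Adj G)) eq (Linkage-Linked G LP p∈)))
    open EdgeSides connected acyclic xz
    p-traverses = Any.map (λ p≡r → pre , post , trans (sym p≡r) eq) p∈
    open ≡-Reasoning
    true≢false : true ≢ false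
    true≢false ()

  Linkage-block-preserved : ∀ {ps qs P Q a b} → ends ps ↭ ends qs → Unique (ends ps) →
                            Linkage G P ps → AllPairs Disjoint P → Linkage G Q qs → AllPairs Disjoint Q →
                            (a , b) ∈ ps → IsBlock qs a b
  Linkage-block-preserved {qs = qs} {Q = Q} {a} {b} ps↭qs ps! LP DP LQ DQ ab∈
    with Linkage-lookup G LP ab∈
  ... | [] , _ , (_ , _ , () , _)
  ... | a ∷ p , p∈ , Pab@(_ , _ , refl , _) = on-path (Linkage-covers G LQ a∈)
    where
    a∈ = Any-resp-↭ ps↭qs (∈-ends₁ ab∈)
    b∈ = Any-resp-↭ ps↭qs (∈-ends₂ ab∈)
    on-path : (∃ λ q → q ∈ Q × a ∈ q) → IsBlock qs a b
    on-path (q , q∈ , a∈q) = Linkage-shared⇒IsBlock G LQ DQ q∈ a∈q b∈q a∈ b∈ (Unique-ends⇒≢ ps! ab∈)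
      where
      p-on-q = SharePath-chain DQ q∈ (infixes⇒Linked (a ∷ p) (edge-covered ps↭qs LP DP LQ p∈)) a∈q
      b∈q = All.lookup p-on-q (IsPath-end∈ G Pab)

  block-preserved : ∀ {X ps qs a b} → Unique X → Feasible G X ps → Feasible G X qs →
                    (a , b) ∈ ps → IsBlock qs a b
  block-preserved {X} X! (ps↭X , _ , LP , DP) (qs↭X , _ , LQ , DQ) =
    Linkage-block-preserved (↭-trans (ends↭ ps↭X) (↭-sym (ends↭ qs↭X)))
                            (Unique-resp-↭ (↭-sym (ends↭ ps↭X)) X!) LP DP LQ DQ
    where
    ends↭ : ∀ {rs} → IsPairPartition G X rs → ends rs ↭ X
    ends↭ {rs} = subst (_↭ X) (concatMap-pairs≡ends (λ _ _ → refl) rs)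

mainTheorem3 : (m : ℕ) (R : Graph m) → IsTree R → (X : List (Fin m)) → Unique X
    → (n : ℕ) → length X ≡ n → (∃ λ k → n ≡ k + k)
    → (ps qs : List (Fin m × Fin m)) → Feasible R X ps → Feasible R X qs
    → SamePartition ps qs
mainTheorem3 m R (connected , acyclic) X X! _ _ _ _ _ Fp Fq a b =
  mk⇔ (transfer Fp Fq) (transfer Fq Fp)
  where
  transfer : ∀ {ps qs} → Feasible R X ps → Feasible R X qs → IsBlock ps a b → IsBlock qs a b
  transfer F F′ = Sum.[ block-preserved connected acyclic X! F F′
                      , Sum.swap ∘ block-preserved connected acyclic X! F F′ ]
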